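{- If $(P,Q,R)$ is $k$-admissible, then $H_n(P,Q,R)$ is $F_k$-free (for every $n$ for which $H_n(P,Q,R)$ is defined).
   Context: The friendship graph $F_k$ consists of $k$ triangles sharing one common vertex. $\nu(G)$ is the matching number and $\Delta(G)$ the maximum degree. $f(\nu,\Delta)=\max\{e(G):\nu(G)\le\nu,\ \Delta(G)\le\Delta\}$. $\mathcal{P}_k$ is the family of all graphs $P$ without isolated vertices with $\nu(P)\le k-1$, $\Delta(P)\le k-1$ and $e(P)=f(k-1,k-1)$. For $P,Q\in\mathcal{P}_k$ with $A=V(P)$, $B=V(Q)$ (disjoint) and a bipartite graph $R$ with parts $A,B$, the triple $(P,Q,R)$ is $k$-admissible if $d_P(a)+\nu(Q[N_R(a)])\le k-1$ for every $a\in A$ and $d_Q(b)+\nu(P[N_R(b)])\le k-1$ for every $b\in B$. Given such a triple, $H_n(P,Q,R)$ is the $n$-vertex graph obtained as follows: take a balanced partition $X\cup Y$ of an $n$-vertex set ($||X|-|Y||\le 1$), place a copy of $P$ on a subset $A\subseteq X$ and a copy of $Q$ on a subset $B\subseteq Y$, with no other edges inside $X$ or inside $Y$; the edges between $X$ and $Y$ are $\bigl((X\times Y)\setminus(A\times B)\bigr)\cup E(R)$, where $X\times Y=\{xy:x\in X,y\in Y\}$. -}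

module Defs where

open import Data.Nat using (ℕ; zero; suc; _+_; _∸_; _≤_)
open import Data.Nat.Base using (_<ᵇ_)
open import Data.Bool using (Bool; true; false; if_then_else_; _∧_; _xor_)
open import Data.Fin using (Fin; toℕ; _≟_)
import Data.Fin as F
open import Data.Unit using (⊤; tt)
open import Data.Sum using (_⊎_; inj₁; inj₂)
open import Data.Product using (_×_; _,_; proj₁; proj₂; ∃-syntax; Σ-syntax)
open import Data.List using (List; []; _∷_; length; concatMap)
open import Data.List.Relation.Unary.All using (All)
open import Data.List.Relation.Unary.Unique.Propositional using (Unique)
open import Relation.Binary.PropositionalEquality using (_≡_; refl)
open import Relation.Nullary.Decidable using (⌊_⌋)
open import Relation.Nullary using (yes; no)
open import Function.Definitions using (Injective)

record Graph (V : Set) : Set where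
  field
    adj    : V → V → Bool
    sym    : ∀ u v → adj u v ≡ adj v u
    irrefl : ∀ v → adj v v ≡ false
open Graph public

count : ∀ {n} → (Fin n → Bool) → ℕ
count {zero}  f = 0
count {suc n} f = (if f F.zero then 1 else 0) + count (λ i → f (F.suc i))

sumFin : ∀ {n} → (Fin n → ℕ) → ℕ
sumFin {zero}  f = 0
sumFin {suc n} f = f F.zero + sumFin (λ i → f (F.suc i))

deg : ∀ {n} → Graph (Fin n) → Fin n → ℕ
deg G v = count (adj G v)

eCount : ∀ {n} → Graph (Fin n) → ℕ
eCount G = sumFin (λ u → count (λ v → adj G u v ∧ (toℕ u <ᵇ toℕ v)))

Δ≤ : ∀ {n} → Graph (Fin n) → ℕ → Set
Δ≤ G t = ∀ v → deg G v ≤ t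

NoIsolated : ∀ {n} → Graph (Fin n) → Set
NoIsolated G = ∀ v → 1 ≤ deg G v

endpoints : ∀ {n} → List (Fin n × Fin n) → List (Fin n)
endpoints = concatMap (λ e → proj₁ e ∷ proj₂ e ∷ [])

IsMatching : ∀ {n} → Graph (Fin n) → List (Fin n × Fin n) → Set
IsMatching G M = All (λ e → adj G (proj₁ e) (proj₂ e) ≡ true) M × Unique (endpoints M)

ν≤ : ∀ {n} → Graph (Fin n) → ℕ → Set
ν≤ G t = ∀ M → IsMatching G M → length M ≤ t

-- The family 𝒫_k  (k - 1 written k ∸ 1; we assume k ≥ 1 in the theorem)
-- e(P) = f(k-1,k-1) is expressed as: P itself satisfies the constraints and
-- e(G) ≤ e(P) for every graph G satisfying them (i.e. P attains the maximum).

InP : (k : ℕ) → ∀ {a} → Graph (Fin a) → Set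
InP k P =
  NoIsolated P × ν≤ P (k ∸ 1) × Δ≤ P (k ∸ 1) ×
  (∀ (m : ℕ) (G : Graph (Fin m)) → ν≤ G (k ∸ 1) → Δ≤ G (k ∸ 1) → eCount G ≤ eCount P)

-- k-admissibility of (P, Q, R), R ⊆ A × B bipartite given by R a b.
-- d_P(a) + ν(Q[N_R(a)]) ≤ k-1 is unfolded as: for every matching M of Q all of
-- whose endpoints lie in N_R(a), d_P(a) + |M| ≤ k-1.

Admissible : (k : ℕ) → ∀ {a b} → Graph (Fin a) → Graph (Fin b) → (Fin a → Fin b → Bool) → Set
Admissible k P Q R =
  (∀ (i : Fin _) (M : List (Fin _ × Fin _)) → IsMatching Q M →
     All (λ j → R i j ≡ true) (endpoints M) → deg P i + length M ≤ k ∸ 1) ×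
  (∀ (j : Fin _) (M : List (Fin _ × Fin _)) → IsMatching P M →
     All (λ i → R i j ≡ true) (endpoints M) → deg Q j + length M ≤ k ∸ 1)

-- H_n(P,Q,R).  X = A ⊎ X', Y = B ⊎ Y' with A = Fin a, |X'| = x', B = Fin b, |Y'| = y'.

HV : ℕ → ℕ → ℕ → ℕ → Set
HV a x' b y' = (Fin a ⊎ Fin x') ⊎ (Fin b ⊎ Fin y')

Hadj : ∀ {a b} x' y' → Graph (Fin a) → Graph (Fin b) → (Fin a → Fin b → Bool) →
       HV a x' b y' → HV a x' b y' → Bool
Hadj x' y' P Q R (inj₁ (inj₁ i)) (inj₁ (inj₁ j)) = adj P i j
Hadj x' y' P Q R (inj₁ _)        (inj₁ _)        = false
Hadj x' y' P Q R (inj₂ (inj₁ i)) (inj₂ (inj₁ j)) = adj Q i j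
Hadj x' y' P Q R (inj₂ _)        (inj₂ _)        = false
Hadj x' y' P Q R (inj₁ (inj₁ i)) (inj₂ (inj₁ j)) = R i j
Hadj x' y' P Q R (inj₂ (inj₁ j)) (inj₁ (inj₁ i)) = R i j
Hadj x' y' P Q R (inj₁ _)        (inj₂ _)        = true
Hadj x' y' P Q R (inj₂ _)        (inj₁ _)        = true

Hsym : ∀ {a b} x' y' P Q R u v → Hadj {a} {b} x' y' P Q R u v ≡ Hadj x' y' P Q R v u
Hsym x' y' P Q R (inj₁ (inj₁ i)) (inj₁ (inj₁ j)) = sym P i j
Hsym x' y' P Q R (inj₁ (inj₁ i)) (inj₁ (inj₂ j)) = refl
Hsym x' y' P Q R (inj₁ (inj₂ i)) (inj₁ (inj₁ j)) = refl
Hsym x' y' P Q R (inj₁ (inj₂ i)) (inj₁ (inj₂ j)) = refl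
Hsym x' y' P Q R (inj₂ (inj₁ i)) (inj₂ (inj₁ j)) = sym Q i j
Hsym x' y' P Q R (inj₂ (inj₁ i)) (inj₂ (inj₂ j)) = refl
Hsym x' y' P Q R (inj₂ (inj₂ i)) (inj₂ (inj₁ j)) = refl
Hsym x' y' P Q R (inj₂ (inj₂ i)) (inj₂ (inj₂ j)) = refl
Hsym x' y' P Q R (inj₁ (inj₁ i)) (inj₂ (inj₁ j)) = refl
Hsym x' y' P Q R (inj₁ (inj₁ i)) (inj₂ (inj₂ j)) = refl
Hsym x' y' P Q R (inj₁ (inj₂ i)) (inj₂ (inj₁ j)) = refl
Hsym x' y' P Q R (inj₁ (inj₂ i)) (inj₂ (inj₂ j)) = refl
Hsym x' y' P Q R (inj₂ (inj₁ j)) (inj₁ (inj₁ i)) = refl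
Hsym x' y' P Q R (inj₂ (inj₁ j)) (inj₁ (inj₂ i)) = refl
Hsym x' y' P Q R (inj₂ (inj₂ j)) (inj₁ (inj₁ i)) = refl
Hsym x' y' P Q R (inj₂ (inj₂ j)) (inj₁ (inj₂ i)) = refl

Hirr : ∀ {a b} x' y' P Q R v → Hadj {a} {b} x' y' P Q R v v ≡ false
Hirr x' y' P Q R (inj₁ (inj₁ i)) = irrefl P i
Hirr x' y' P Q R (inj₁ (inj₂ i)) = refl
Hirr x' y' P Q R (inj₂ (inj₁ i)) = irrefl Q i
Hirr x' y' P Q R (inj₂ (inj₂ i)) = refl

H : ∀ {a b} x' y' → Graph (Fin a) → Graph (Fin b) → (Fin a → Fin b → Bool) → Graph (HV a x' b y')
H x' y' P Q R = record
  { adj = Hadj x' y' P Q R ; sym = Hsym x' y' P Q R ; irrefl = Hirr x' y' P Q R }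

-- Friendship graph F_k: centre inj₁ tt, triangle i on centre, (i,false), (i,true).

FV : ℕ → Set
FV k = ⊤ ⊎ (Fin k × Bool)

Fadj : ∀ k → FV k → FV k → Bool
Fadj k (inj₁ _) (inj₁ _) = false
Fadj k (inj₁ _) (inj₂ _) = true
Fadj k (inj₂ _) (inj₁ _) = true
Fadj k (inj₂ (i , s)) (inj₂ (j , t)) = ⌊ i ≟ j ⌋ ∧ (s xor t)

private
  eqsym : ∀ {k} (i j : Fin k) → ⌊ i ≟ j ⌋ ≡ ⌊ j ≟ i ⌋
  eqsym i j with i ≟ j | j ≟ i
  ... | yes _ | yes _ = refl
  ... | no _  | no _  = refl
  ... | yes refl | no n = Data.Empty.⊥-elim (n refl)
    where import Data.Empty
  ... | no n | yes refl = Data.Empty.⊥-elim (n refl)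
    where import Data.Empty

  xorsym : ∀ s t → (s xor t) ≡ (t xor s)
  xorsym false false = refl
  xorsym false true  = refl
  xorsym true  false = refl
  xorsym true  true  = refl

  ∧false : ∀ b → (b ∧ false) ≡ false
  ∧false false = refl
  ∧false true  = refl

  xorself : ∀ s → (s xor s) ≡ false
  xorself false = refl
  xorself true  = refl

Fsym : ∀ k u v → Fadj k u v ≡ Fadj k v u
Fsym k (inj₁ _) (inj₁ _) = refl
Fsym k (inj₁ _) (inj₂ _) = refl
Fsym k (inj₂ _) (inj₁ _) = refl
Fsym k (inj₂ (i , s)) (inj₂ (j , t)) rewrite eqsym i j | xorsym s t = refl

Firr : ∀ k v → Fadj k v v ≡ false
Firr k (inj₁ _) = refl
Firr k (inj₂ (i , s)) rewrite xorself s = ∧false ⌊ i ≟ i ⌋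

Friendship : (k : ℕ) → Graph (FV k)
Friendship k = record { adj = Fadj k ; sym = Fsym k ; irrefl = Firr k }

Contains : ∀ {V W : Set} → Graph V → Graph W → Set
Contains {V} {W} G F =
  Σ[ φ ∈ (W → V) ] (Injective _≡_ _≡_ φ × (∀ u v → adj F u v ≡ true → adj G (φ u) (φ v) ≡ true))

Free : ∀ {V W : Set} → Graph W → Graph V → Set
Free F G = Contains G F → Data.Empty.⊥
  where import Data.Empty

{-# OPTIONS --safe #-}
-- Suppose F_k embeds in H, and by the symmetry X ↔ Y let its centre c lie in X.
-- Every triangle through c either has a vertex in A (a P-neighbour of c, so c ∈ A)
-- or has its other two vertices in B, forming a Q-edge inside N_H(c).  Since the
-- k triangles are vertex-disjoint apart from c, this yields k ≤ |L| + |M| for a set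
-- L ⊆ N_P(c) and a matching M of Q[N_H(c)].  If c ∈ A this contradicts
-- d_P(c) + ν(Q[N_R(c)]) ≤ k - 1; if c ∈ X ∖ A then L = ∅ and it contradicts ν(Q) ≤ k - 1.
module Submission where

open import Defs
open import Data.Nat using (ℕ; zero; suc; _+_; _∸_; _≤_; z≤n; s≤s)
open import Data.Nat.Properties using (≤-trans; ≤-reflexive; +-suc; +-comm; +-monoʳ-≤; +-identityʳ; 1+n≰n; module ≤-Reasoning)
open import Data.Bool using (Bool; true; false; _∧_)
open import Data.Fin using (Fin; _≟_)
import Data.Fin as F
open import Data.Unit using (tt)
open import Data.Sum using (_⊎_; inj₁; inj₂; swap)
open import Data.Sum.Properties using (swap-involutive)
open import Data.Product using (_×_; _,_; proj₁; proj₂; ∃-syntax)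
open import Data.List using (List; []; _∷_; length; allFin)
open import Data.List.Properties using (length-tabulate)
open import Data.List.Relation.Unary.All using (All; []; _∷_)
import Data.List.Relation.Unary.All as All
open import Data.List.Relation.Unary.AllPairs using ([]; _∷_)
open import Data.List.Relation.Unary.Unique.Propositional using (Unique)
open import Data.List.Relation.Unary.Unique.Propositional.Properties using (allFin⁺)
open import Data.List.Membership.Propositional using (_∈_)
open import Data.List.Relation.Unary.Any using (here; there)
open import Data.Empty using (⊥)
open import Relation.Nullary using (¬_)
open import Function using (_∘_; flip; id; case_of_)
open import Relation.Binary.PropositionalEquality using (_≡_; _≢_; refl; trans; cong; subst; subst₂)
import Relation.Binary.PropositionalEquality as ≡
open import Relation.Nullary.Decidable using (isYes≗does; dec-true)

lower : ∀ {n} → List (Fin (suc n)) → List (Fin n)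
lower []             = []
lower (F.zero  ∷ xs) = lower xs
lower (F.suc j ∷ xs) = j ∷ lower xs

lower-All : ∀ {n p} {Pr : Fin (suc n) → Set p} {xs} → All Pr xs → All (Pr ∘ F.suc) (lower xs)
lower-All {xs = []}           []       = []
lower-All {xs = F.zero  ∷ xs} (_ ∷ ps) = lower-All ps
lower-All {xs = F.suc j ∷ xs} (p ∷ ps) = p ∷ lower-All ps

lower-unique : ∀ {n} {xs : List (Fin (suc n))} → Unique xs → Unique (lower xs)
lower-unique {xs = []}           []       = []
lower-unique {xs = F.zero  ∷ xs} (_ ∷ u)  = lower-unique u
lower-unique {xs = F.suc j ∷ xs} (p ∷ u)  = All.map (_∘ cong F.suc) (lower-All p) ∷ lower-unique u

length-lower-zero∉ : ∀ {n} {xs : List (Fin (suc n))} → All (F.zero ≢_) xs → length xs ≤ length (lower xs)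
length-lower-zero∉ {xs = []}           []       = z≤n
length-lower-zero∉ {xs = F.zero  ∷ xs} (p ∷ _)  with () ← p refl
length-lower-zero∉ {xs = F.suc j ∷ xs} (_ ∷ ps) = s≤s (length-lower-zero∉ ps)

length-lower : ∀ {n} {xs : List (Fin (suc n))} → Unique xs → length xs ≤ suc (length (lower xs))
length-lower {xs = []}           []      = z≤n
length-lower {xs = F.zero  ∷ xs} (p ∷ _) = s≤s (length-lower-zero∉ p)
length-lower {xs = F.suc j ∷ xs} (_ ∷ u) = s≤s (length-lower u)

length≤count : ∀ {n} (f : Fin n → Bool) {xs} → Unique xs → All (λ x → f x ≡ true) xs → length xs ≤ count f
length≤count {zero}  f {[]}    _ _ = z≤n
length≤count {suc n} f u fxs with f F.zero in f0
... | true  = ≤-trans (length-lower u) (s≤s (length≤count (f ∘ F.suc) (lower-unique u) (lower-All fxs)))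
... | false = ≤-trans (length-lower-zero∉ (All.map zero≢ fxs)) (length≤count (f ∘ F.suc) (lower-unique u) (lower-All fxs))
  where
  zero≢ : ∀ {x} → f x ≡ true → F.zero ≢ x
  zero≢ fx refl with () ← trans (≡.sym f0) fx

centre : ∀ {k} → FV k
centre = inj₁ tt

leaf : ∀ {k} → Fin k → Bool → FV k
leaf i s = inj₂ (i , s)

leaf-adj-leaf : ∀ {k} (i : Fin k) → Fadj k (leaf i false) (leaf i true) ≡ true
leaf-adj-leaf i = cong (_∧ true) (trans (isYes≗does (i ≟ i)) (dec-true (i ≟ i) refl))

module _ {a b : ℕ} {x′ y′ : ℕ} where

  inA : Fin a → HV a x′ b y′
  inA = inj₁ ∘ inj₁

  inB : Fin b → HV a x′ b y′
  inB = inj₂ ∘ inj₁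

  Hadj-swap : ∀ (P : Graph (Fin a)) (Q : Graph (Fin b)) R u v →
              Hadj y′ x′ Q P (flip R) (swap u) (swap v) ≡ Hadj x′ y′ P Q R u v
  Hadj-swap P Q R (inj₁ (inj₁ _)) (inj₁ (inj₁ _)) = refl
  Hadj-swap P Q R (inj₁ (inj₁ _)) (inj₁ (inj₂ _)) = refl
  Hadj-swap P Q R (inj₁ (inj₂ _)) (inj₁ _)        = refl
  Hadj-swap P Q R (inj₂ (inj₁ _)) (inj₂ (inj₁ _)) = refl
  Hadj-swap P Q R (inj₂ (inj₁ _)) (inj₂ (inj₂ _)) = refl
  Hadj-swap P Q R (inj₂ (inj₂ _)) (inj₂ _)        = refl
  Hadj-swap P Q R (inj₁ (inj₁ _)) (inj₂ (inj₁ _)) = refl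
  Hadj-swap P Q R (inj₁ (inj₁ _)) (inj₂ (inj₂ _)) = refl
  Hadj-swap P Q R (inj₁ (inj₂ _)) (inj₂ _)        = refl
  Hadj-swap P Q R (inj₂ (inj₁ _)) (inj₁ (inj₁ _)) = refl
  Hadj-swap P Q R (inj₂ (inj₁ _)) (inj₁ (inj₂ _)) = refl
  Hadj-swap P Q R (inj₂ (inj₂ _)) (inj₁ _)        = refl

  Contains-H-swap : ∀ {W} {F : Graph W} (P : Graph (Fin a)) (Q : Graph (Fin b)) R →
                    Contains (H x′ y′ P Q R) F → Contains (H y′ x′ Q P (flip R)) F
  Contains-H-swap P Q R (φ , φ-inj , φ-hom) =
    swap ∘ φ , φ-inj ∘ swap-injective , λ u v uv → trans (Hadj-swap P Q R (φ u) (φ v)) (φ-hom u v uv)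
    where
    swap-injective : ∀ {u v : HV a x′ b y′} → swap u ≡ swap v → u ≡ v
    swap-injective {u} {v} eq = trans (≡.sym (swap-involutive u)) (trans (cong swap eq) (swap-involutive v))

  data EdgeNearX (U W : HV a x′ b y′) : Set where
    fst∈A : ∀ j → U ≡ inA j → EdgeNearX U W
    snd∈A : ∀ j → W ≡ inA j → EdgeNearX U W
    edge∈Q : ∀ p q → U ≡ inB p → W ≡ inB q → EdgeNearX U W

  edgeNearX : ∀ {P : Graph (Fin a)} {Q : Graph (Fin b)} {R} cx U W →
              let adjH = Hadj x′ y′ P Q R in
              adjH (inj₁ cx) U ≡ true → adjH (inj₁ cx) W ≡ true → adjH U W ≡ true →
              EdgeNearX U W
  edgeNearX cx        (inj₁ (inj₁ j)) W               _  _  _  = fst∈A j refl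
  edgeNearX (inj₁ _)  (inj₁ (inj₂ _)) W               () _  _
  edgeNearX (inj₂ _)  (inj₁ (inj₂ _)) W               () _  _
  edgeNearX cx        (inj₂ U)        (inj₁ (inj₁ j)) _  _  _  = snd∈A j refl
  edgeNearX (inj₁ _)  (inj₂ U)        (inj₁ (inj₂ _)) _  () _
  edgeNearX (inj₂ _)  (inj₂ U)        (inj₁ (inj₂ _)) _  () _
  edgeNearX cx        (inj₂ (inj₁ p)) (inj₂ (inj₁ q)) _  _  _  = edge∈Q p q refl refl
  edgeNearX cx        (inj₂ (inj₁ _)) (inj₂ (inj₂ _)) _  _  ()
  edgeNearX cx        (inj₂ (inj₂ _)) (inj₂ _)        _  _  ()

module CentreInX {m a b x′ y′ : ℕ} {P : Graph (Fin a)} {Q : Graph (Fin b)} {R : Fin a → Fin b → Bool}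
  (φ : FV (suc m) → HV a x′ b y′) (φ-inj : ∀ {u v} → φ u ≡ φ v → u ≡ v)
  (φ-hom : ∀ u v → Fadj (suc m) u v ≡ true → Hadj x′ y′ P Q R (φ u) (φ v) ≡ true)
  (cx : Fin a ⊎ Fin x′) (φ-centre : φ centre ≡ inj₁ cx) where

  adjH : HV a x′ b y′ → HV a x′ b y′ → Bool
  adjH = Hadj x′ y′ P Q R

  Triangle : Set
  Triangle = Fin (suc m)

  -- `Used ts v` tracks which triangle each chosen vertex comes from, so that
  -- vertices of a further triangle are seen to be new.
  Used : List Triangle → HV a x′ b y′ → Set
  Used ts v = ∃[ t ] (proj₁ t ∈ ts × φ (inj₂ t) ≡ v)

  Used-∷ : ∀ {i ts v} → Used ts v → Used (i ∷ ts) v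
  Used-∷ (t , t∈ts , eq) = t , there t∈ts , eq

  Used-fresh : ∀ {i ts v} s → All (i ≢_) ts → Used ts v → φ (leaf i s) ≢ v
  Used-fresh s i∉ts ((i′ , s′) , i′∈ts , refl) eq with refl ← φ-inj eq = All.lookup i∉ts i′∈ts refl

  adj-centre : ∀ t → adjH (inj₁ cx) (φ (inj₂ t)) ≡ true
  adj-centre t = subst (λ c → adjH c (φ (inj₂ t)) ≡ true) φ-centre (φ-hom centre (inj₂ t) refl)

  Used⇒adj-centre : ∀ {ts v} → Used ts v → adjH (inj₁ cx) v ≡ true
  Used⇒adj-centre (t , _ , refl) = adj-centre t

  record Packing (ts : List Triangle) : Set where
    field
      M          : List (Fin b × Fin b)
      L          : List (Fin a)
      covers     : length ts ≤ length M + length L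
      M-matching : IsMatching Q M
      L-unique   : Unique L
      M-used     : All (Used ts ∘ inB) (endpoints M)
      L-used     : All (Used ts ∘ inA) L

  triangleNearX : ∀ i → EdgeNearX (φ (leaf i false)) (φ (leaf i true))
  triangleNearX i = edgeNearX cx _ _ (adj-centre (i , false)) (adj-centre (i , true)) (φ-hom _ _ (leaf-adj-leaf i))

  add-leaf : ∀ {i ts} s j → All (i ≢_) ts → φ (leaf i s) ≡ inA j → Packing ts → Packing (i ∷ ts)
  add-leaf {i} s j i∉ts eq π = record
    { M = M ; L = j ∷ L
    ; covers = ≤-trans (s≤s covers) (≤-reflexive (≡.sym (+-suc (length M) (length L))))
    ; M-matching = M-matching
    ; L-unique = All.map (λ u j≡ → Used-fresh s i∉ts u (trans eq (cong inA j≡))) L-used ∷ L-unique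
    ; M-used = All.map Used-∷ M-used
    ; L-used = ((i , s) , here refl , eq) ∷ All.map Used-∷ L-used
    }
    where open Packing π

  add-edge : ∀ {i ts} p q → All (i ≢_) ts → φ (leaf i false) ≡ inB p → φ (leaf i true) ≡ inB q →
             Packing ts → Packing (i ∷ ts)
  add-edge {i} p q i∉ts eq-p eq-q π = record
    { M = (p , q) ∷ M ; L = L
    ; covers = s≤s covers
    ; M-matching = (pq-edge ∷ proj₁ M-matching) , ((p≢q ∷ fresh false eq-p) ∷ fresh true eq-q ∷ proj₂ M-matching)
    ; L-unique = L-unique
    ; M-used = ((i , false) , here refl , eq-p) ∷ ((i , true) , here refl , eq-q) ∷ All.map Used-∷ M-used
    ; L-used = All.map Used-∷ L-used
    }
    where
    open Packing π
    pq-edge : adj Q p q ≡ true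
    pq-edge = subst₂ (λ U W → adjH U W ≡ true) eq-p eq-q (φ-hom _ _ (leaf-adj-leaf i))
    p≢q : p ≢ q
    p≢q refl with () ← φ-inj (trans eq-p (≡.sym eq-q))
    fresh : ∀ {r} s → φ (leaf i s) ≡ inB r → All (r ≢_) (endpoints M)
    fresh s eq = All.map (λ u r≡ → Used-fresh s i∉ts u (trans eq (cong inB r≡))) M-used

  pack : ∀ ts → Unique ts → Packing ts
  pack []       []           = record { M = [] ; L = [] ; covers = z≤n ; M-matching = [] , []
                                      ; L-unique = [] ; M-used = [] ; L-used = [] }
  pack (i ∷ ts) (i∉ts ∷ uts) with triangleNearX i
  ... | fst∈A j eq       = add-leaf false j i∉ts eq (pack ts uts)
  ... | snd∈A j eq       = add-leaf true  j i∉ts eq (pack ts uts)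
  ... | edge∈Q p q ep eq = add-edge p q i∉ts ep eq (pack ts uts)

  covering : Packing (allFin (suc m))
  covering = pack (allFin (suc m)) (allFin⁺ (suc m))

AdmissibleFrom : (k : ℕ) → ∀ {a b} → Graph (Fin a) → Graph (Fin b) → (Fin a → Fin b → Bool) → Set
AdmissibleFrom k P Q R =
  ∀ i M → IsMatching Q M → All (λ j → R i j ≡ true) (endpoints M) → deg P i + length M ≤ k ∸ 1

length-All-absurd : ∀ {A : Set} {Pr : A → Set} {xs} → (∀ {x} → ¬ Pr x) → All Pr xs → length xs ≡ 0
length-All-absurd ¬Pr []      = refl
length-All-absurd ¬Pr (p ∷ _) with () ← ¬Pr p

no-friendship-centred-in-X : ∀ {m a b x′ y′} {P : Graph (Fin a)} {Q : Graph (Fin b)} {R} →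
  ν≤ Q m → AdmissibleFrom (suc m) P Q R →
  (F⊆H : Contains (H x′ y′ P Q R) (Friendship (suc m))) → ∀ {cx} → proj₁ F⊆H centre ≡ inj₁ cx → ⊥
no-friendship-centred-in-X {m} {P = P} _ adm (φ , φ-inj , φ-hom) {inj₁ c} φc = 1+n≰n (begin
  suc m                   ≡⟨ ≡.sym (length-tabulate id) ⟩
  length (allFin (suc m)) ≤⟨ covers ⟩
  length M + length L     ≤⟨ +-monoʳ-≤ (length M) L≤deg ⟩
  length M + deg P c      ≡⟨ +-comm (length M) (deg P c) ⟩
  deg P c + length M      ≤⟨ adm c M M-matching (All.map Used⇒adj-centre M-used) ⟩
  m                       ∎)
  where
  open ≤-Reasoning
  open CentreInX φ φ-inj φ-hom _ φc
  open Packing covering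
  L≤deg : length L ≤ deg P c
  L≤deg = length≤count (adj P c) L-unique (All.map Used⇒adj-centre L-used)
no-friendship-centred-in-X {m} νQ _ (φ , φ-inj , φ-hom) {inj₂ z} φc = 1+n≰n (begin
  suc m                   ≡⟨ ≡.sym (length-tabulate id) ⟩
  length (allFin (suc m)) ≤⟨ covers ⟩
  length M + length L     ≡⟨ cong (length M +_) L-empty ⟩
  length M + 0            ≡⟨ +-identityʳ (length M) ⟩
  length M                ≤⟨ νQ M M-matching ⟩
  m                       ∎)
  where
  open ≤-Reasoning
  open CentreInX φ φ-inj φ-hom _ φc
  open Packing covering
  L-empty : length L ≡ 0
  L-empty = length-All-absurd (λ u → case Used⇒adj-centre u of λ ()) L-used

lemma2p2 : (k : ℕ) → 1 ≤ k → {a b : ℕ} →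
    (P : Graph (Fin a)) (Q : Graph (Fin b)) (R : Fin a → Fin b → Bool) →
    InP k P → InP k Q → Admissible k P Q R →
    (n x' y' : ℕ) → (a + x') + (b + y') ≡ n →
    a + x' ≤ 1 + (b + y') → b + y' ≤ 1 + (a + x') →
    Free (Friendship k) (H x' y' P Q R)
lemma2p2 zero    ()
lemma2p2 (suc m) _ P Q R (_ , νP , _) (_ , νQ , _) (admP , admQ) n x' y' _ _ _ F⊆H@(φ , _) with φ centre in φc
... | inj₁ _ = no-friendship-centred-in-X νQ admP F⊆H φc
... | inj₂ _ = no-friendship-centred-in-X νP admQ (Contains-H-swap {F = Friendship (suc m)} P Q R F⊆H) (cong swap φc)
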